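{- There exists a frameless $2$-coloring of the plane lattice $\mathbb{Z}\times\mathbb{Z}$.
   Context: A $k$-coloring of $\mathbb{Z}\times\mathbb{Z}$ is a map $f:\mathbb{Z}\times\mathbb{Z}\to\Delta$ where $\Delta$ is a finite set of $k$ colors. A picture frame in $f$ is a rectangular block of lattice points with at least two rows and at least two columns whose first row equals its last row and whose first column equals its last column; that is, integers $m,n$ and $p,q\ge 1$ such that $f(m,n+i)=f(m+p,n+i)$ for all $0\le i\le q$ and $f(m+j,n)=f(m+j,n+q)$ for all $0\le j\le p$. The coloring $f$ is frameless if it contains no picture frame. -}

module Defs where

open import Data.Nat using (ℕ; suc; _≤_)
open import Data.Integer using (ℤ; +_; _+_)
open import Data.Fin using (Fin)
open import Data.Product using (Σ; _×_; ∃-syntax)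
open import Relation.Binary.PropositionalEquality using (_≡_)
open import Relation.Nullary using (¬_)

Coloring : ℕ → Set
Coloring k = ℤ → ℤ → Fin k

IsFrame : ∀ {k} → Coloring k → ℤ → ℤ → ℕ → ℕ → Set
IsFrame f m n p q =
  1 ≤ p × 1 ≤ q ×
  ((i : ℕ) → i ≤ q → f m (n + + i) ≡ f (m + + p) (n + + i)) ×
  ((j : ℕ) → j ≤ p → f (m + + j) n ≡ f (m + + j) (n + + q))

HasFrame : ∀ {k} → Coloring k → Set
HasFrame f = ∃[ m ] ∃[ n ] ∃[ p ] ∃[ q ] IsFrame f m n p q

Frameless : ∀ {k} → Coloring k → Set
Frameless f = ¬ HasFrame f

-- Colour (m, n) by a two-sided Thue–Morse word w at m + n. If a frame has p ≤ q, its first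
-- and last rows say that w(s + j) = w(s + j + p) for j ≤ p, where s = m + n: the factor of
-- length 2p + 1 at s is an overlap (symmetrically for columns when q ≤ p). Thue–Morse words
-- are overlap-free by desubstitution: w(2k) = w′(k) and w(2k + 1) = ¬ w′(k) for another such
-- word w′. An overlap of even period 2r halves to one of period r in w′. For odd period every
-- position of the overlap alternates, since one of s + j, s + j ± p is even and aligned pairs
-- (2k, 2k + 1) always differ; hence w(2c) = w(2c + 2) = w(2c + 4), i.e. w′(c) = w′(c + 1) =
-- w′(c + 2), which is impossible for the same reason.
module Submission where

open import Data.Bool using (Bool; false; not; _xor_)
open import Data.Bool.Properties
  using (not-involutive; not-injective; not-¬; not-distribˡ-xor; not-distribʳ-xor)
open import Data.Empty using (⊥)
open import Data.Fin using (Fin)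
open import Data.Fin.Properties using (2↔Bool)
open import Data.Integer using (ℤ; +_; -[1+_]; _+_; _-_)
open import Data.Integer.Properties using (pos-+; +-assoc; +-identityʳ)
open import Data.Integer.Tactic.RingSolver using (solve-∀)
open import Data.Nat using (ℕ; zero; suc; _≤_; _<_; z≤n; s≤s; ⌊_/2⌋)
import Data.Nat as ℕ
import Data.Nat.Properties as ℕ
open import Data.Nat.Induction using (<-rec)
open import Algebra.Properties.CommutativeSemigroup ℕ.+-commutativeSemigroup
  using () renaming (interchange to +-interchange)
open import Data.Product using (∃-syntax; _,_; _×_)
open import Data.Sum using (_⊎_; inj₁; inj₂)
open import Function using (_∘_)
open import Function.Bundles using (Injection; _↣_)
open import Function.Definitions using (Injective)
open import Function.Properties.Inverse using (↔-sym; ↔⇒↣)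
open import Relation.Binary.PropositionalEquality
open import Relation.Nullary using (¬_; yes; no)

open import Defs

data Parity : ℕ → Set where
  even : ∀ k → Parity (k ℕ.+ k)
  odd  : ∀ k → Parity (suc (k ℕ.+ k))

parity : ∀ n → Parity n
parity zero = even 0
parity (suc n) with parity n
... | even k = odd k
... | odd k  = subst Parity (cong suc (ℕ.+-suc k k)) (even (suc k))

Even Odd : ℤ → Set
Even z = ∃[ k ] z ≡ k + k
Odd  z = ∃[ k ] z ≡ k + k + + 1

even-or-odd : ∀ z → Even z ⊎ Odd z
even-or-odd (+ n) with parity n
... | even k = inj₁ (+ k , refl)
... | odd k  = inj₂ (+ k , cong +_ (ℕ.+-comm 1 (k ℕ.+ k)))
even-or-odd -[1+ n ] with parity n
... | even k = inj₂ (-[1+ k ] , refl)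
... | odd k  = inj₁ (-[1+ k ] , refl)

odd⇒suc-even : ∀ {x} → Odd x → Even (x + + 1)
odd⇒suc-even (k , refl) = k + + 1 , identity k
  where
  identity : ∀ k → k + k + + 1 + + 1 ≡ (k + + 1) + (k + + 1)
  identity = solve-∀

even-within-one : ∀ z → ∃[ o ] o ≤ 1 × Even (z + + o)
even-within-one z with even-or-odd z
... | inj₁ (k , z≡2k) = 0 , z≤n , k , trans (+-identityʳ z) z≡2k
... | inj₂ z-odd      = 1 , s≤s z≤n , odd⇒suc-even z-odd

odd+odd-even : ∀ {x y} → Odd x → Odd y → Even (x + y)
odd+odd-even (k , refl) (l , refl) = k + l + + 1 , identity k l
  where
  identity : ∀ k l → (k + k + + 1) + (l + l + + 1) ≡ (k + l + + 1) + (k + l + + 1)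
  identity = solve-∀

odd-odd-even : ∀ {x y} → Odd x → Odd y → Even (x - y)
odd-odd-even (k , refl) (l , refl) = k - l , identity k l
  where
  identity : ∀ k l → (k + k + + 1) - (l + l + + 1) ≡ (k - l) + (k - l)
  identity = solve-∀

odd-suc-double : ∀ r → Odd (+ suc (r ℕ.+ r))
odd-suc-double r = + r , cong +_ (ℕ.+-comm 1 (r ℕ.+ r))

+-pos-+ : ∀ s m n → s + + (m ℕ.+ n) ≡ s + + m + + n
+-pos-+ s m n = trans (cong (λ x → s + x) (pos-+ m n)) (sym (+-assoc s (+ m) (+ n)))

+-pos-suc : ∀ s n → s + + suc n ≡ s + + n + + 1
+-pos-suc s n = trans (cong (λ m → s + + m) (ℕ.+-comm 1 n)) (+-pos-+ s n 1)

double-+-pos-double : ∀ k n → k + k + + (n ℕ.+ n) ≡ (k + + n) + (k + + n)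
double-+-pos-double k n = trans (cong (λ x → k + k + x) (pos-+ n n)) (identity k (+ n))
  where
  identity : ∀ k m → k + k + (m + m) ≡ (k + m) + (k + m)
  identity = solve-∀

double+1-+-pos-double : ∀ k n → k + k + + 1 + + (n ℕ.+ n) ≡ (k + + n) + (k + + n) + + 1
double+1-+-pos-double k n = trans (cong (λ x → k + k + + 1 + x) (pos-+ n n)) (identity k (+ n))
  where
  identity : ∀ k m → k + k + + 1 + (m + m) ≡ (k + m) + (k + m) + + 1
  identity = solve-∀

isOdd : ℕ → Bool
isOdd zero    = false
isOdd (suc n) = not (isOdd n)

isOdd-double : ∀ n → isOdd (n ℕ.+ n) ≡ false
isOdd-double zero = refl
isOdd-double (suc n) rewrite ℕ.+-suc n n = trans (not-involutive _) (isOdd-double n)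

⌊1+n+n/2⌋≡n : ∀ n → ⌊ suc (n ℕ.+ n) /2⌋ ≡ n
⌊1+n+n/2⌋≡n zero = refl
⌊1+n+n/2⌋≡n (suc n) rewrite ℕ.+-suc n n = cong suc (⌊1+n+n/2⌋≡n n)

-- Any fuel f ≥ n computes the Thue–Morse letter t(n); the clause with zero fuel is then never reached.
thueMorseFuel : ℕ → ℕ → Bool
thueMorseFuel _       zero    = false
thueMorseFuel zero    (suc _) = false
thueMorseFuel (suc f) (suc n) = isOdd (suc n) xor thueMorseFuel f ⌊ suc n /2⌋

thueMorseFuel-stable : ∀ {f g n} → n ≤ f → n ≤ g → thueMorseFuel f n ≡ thueMorseFuel g n
thueMorseFuel-stable {n = zero} _ _ = refl
thueMorseFuel-stable {suc f} {suc g} {suc n} (s≤s n≤f) (s≤s n≤g) =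
  cong (isOdd (suc n) xor_) (thueMorseFuel-stable (ℕ.≤-trans half≤n n≤f) (ℕ.≤-trans half≤n n≤g))
  where
  half≤n : ⌊ suc n /2⌋ ≤ n
  half≤n = ℕ.≤-pred (ℕ.⌊n/2⌋<n n)

thueMorse : ℕ → Bool
thueMorse n = thueMorseFuel n n

thueMorse-unfold : ∀ n → thueMorse n ≡ isOdd n xor thueMorse ⌊ n /2⌋
thueMorse-unfold zero    = refl
thueMorse-unfold (suc n) =
  cong (isOdd (suc n) xor_) (thueMorseFuel-stable (ℕ.≤-pred (ℕ.⌊n/2⌋<n n)) ℕ.≤-refl)

thueMorse-double : ∀ n → thueMorse (n ℕ.+ n) ≡ thueMorse n
thueMorse-double n = trans (thueMorse-unfold (n ℕ.+ n))
  (cong₂ _xor_ (isOdd-double n) (cong thueMorse (sym (ℕ.n≡⌊n+n/2⌋ n))))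

thueMorse-double+1 : ∀ n → thueMorse (suc (n ℕ.+ n)) ≡ not (thueMorse n)
thueMorse-double+1 n = trans (thueMorse-unfold (suc (n ℕ.+ n)))
  (cong₂ _xor_ (cong not (isOdd-double n)) (cong thueMorse (⌊1+n+n/2⌋≡n n)))

-- Doubling -[1+ n ] gives -[1+ 2n+1 ], so on the negative half the parity of the
-- reflected index shifts; the complementing bit b absorbs this and flips at each doubling.
thueMorseℤ : Bool → ℤ → Bool
thueMorseℤ b (+ n)    = thueMorse n
thueMorseℤ b -[1+ n ] = b xor thueMorse n

thueMorseℤ-double : ∀ b k → thueMorseℤ b (k + k) ≡ thueMorseℤ (not b) k
thueMorseℤ-double b (+ n)    = thueMorse-double n
thueMorseℤ-double b -[1+ n ] = begin
  b xor thueMorse (suc (n ℕ.+ n)) ≡⟨ cong (b xor_) (thueMorse-double+1 n) ⟩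
  b xor not (thueMorse n)         ≡⟨ sym (not-distribʳ-xor b _) ⟩
  not (b xor thueMorse n)         ≡⟨ not-distribˡ-xor b _ ⟩
  not b xor thueMorse n           ∎
  where open ≡-Reasoning

thueMorseℤ-double+1 : ∀ b k → thueMorseℤ b (k + k + + 1) ≡ not (thueMorseℤ (not b) k)
thueMorseℤ-double+1 b (+ n) =
  trans (cong thueMorse (ℕ.+-comm (n ℕ.+ n) 1)) (thueMorse-double+1 n)
thueMorseℤ-double+1 b -[1+ n ] = begin
  b xor thueMorse (n ℕ.+ n)       ≡⟨ cong (b xor_) (thueMorse-double n) ⟩
  b xor thueMorse n               ≡⟨ cong (_xor thueMorse n) (sym (not-involutive b)) ⟩
  not (not b) xor thueMorse n     ≡⟨ sym (not-distribˡ-xor (not b) _) ⟩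
  not (not b xor thueMorse n)     ∎
  where open ≡-Reasoning

-- The factor v(s) … v(s + 2p) has period p: an overlap axaxa with |ax| = p.
record Overlap {A : Set} (v : ℤ → A) (s : ℤ) (p : ℕ) : Set where
  constructor mkOverlap
  field period : ∀ j → j ≤ p → v (s + + j) ≡ v (s + + (j ℕ.+ p))
open Overlap

OverlapFree : {A : Set} → (ℤ → A) → Set
OverlapFree v = ∀ s p → 1 ≤ p → ¬ Overlap v s p

Alternates : (ℤ → Bool) → ℤ → Set
Alternates v z = v (z + + 1) ≡ not (v z)

module _ {A : Set} {v : ℤ → A} {s : ℤ} where

  overlap-at-doubles : ∀ {r} → Overlap v s (r ℕ.+ r) →
                       ∀ j → j ≤ r → v (s + + (j ℕ.+ j)) ≡ v (s + + ((j ℕ.+ r) ℕ.+ (j ℕ.+ r)))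
  overlap-at-doubles {r} ov j j≤r = trans (period ov (j ℕ.+ j) (ℕ.+-mono-≤ j≤r j≤r))
    (cong (λ n → v (s + + n)) (+-interchange j j r r))

  overlap-pair : ∀ {p d} → Overlap v s p → suc d ≤ p →
                 v (s + + d) ≡ v (s + + (d ℕ.+ p)) × v (s + + d + + 1) ≡ v (s + + (d ℕ.+ p) + + 1)
  overlap-pair {p} {d} ov d<p =
      period ov d (ℕ.<⇒≤ d<p)
    , trans (cong v (sym (+-pos-suc s d)))
        (trans (period ov (suc d) d<p) (cong v (+-pos-suc s (d ℕ.+ p))))

alternation-transfer : ∀ {v x y} → v x ≡ v y → v (x + + 1) ≡ v (y + + 1) →
                       Alternates v x → Alternates v y
alternation-transfer vx≡vy vx+1≡vy+1 alt = trans (sym vx+1≡vy+1) (trans alt (cong not vx≡vy))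

module _ {v : ℤ → Bool} {s : ℤ} where

  overlap-alternation-forward : ∀ {p d} → Overlap v s p → suc d ≤ p →
                                Alternates v (s + + d) → Alternates v (s + + (d ℕ.+ p))
  overlap-alternation-forward ov d<p =
    let e , e₁ = overlap-pair ov d<p in alternation-transfer {v = v} e e₁

  overlap-alternation-backward : ∀ {p d} → Overlap v s p → suc d ≤ p →
                                 Alternates v (s + + (d ℕ.+ p)) → Alternates v (s + + d)
  overlap-alternation-backward ov d<p =
    let e , e₁ = overlap-pair ov d<p in alternation-transfer {v = v} (sym e) (sym e₁)

  alternates-twice : ∀ {j} → Alternates v (s + + j) → Alternates v (s + + suc j) →
                     v (s + + suc (suc j)) ≡ v (s + + j)
  alternates-twice {j} alt alt₁ = begin
    v (s + + suc (suc j))     ≡⟨ cong v (+-pos-suc s (suc j)) ⟩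
    v (s + + suc j + + 1)     ≡⟨ alt₁ ⟩
    not (v (s + + suc j))     ≡⟨ cong (not ∘ v) (+-pos-suc s j) ⟩
    not (v (s + + j + + 1))   ≡⟨ cong not alt ⟩
    not (not (v (s + + j)))   ≡⟨ not-involutive _ ⟩
    v (s + + j)               ∎
    where open ≡-Reasoning

module SelfSimilar {I : Set} (σ : I → I) (w : I → ℤ → Bool)
  (w-double   : ∀ i k → w i (k + k) ≡ w (σ i) k)
  (w-double+1 : ∀ i k → w i (k + k + + 1) ≡ not (w (σ i) k))
  where

  w-double-shift : ∀ i k n → w i (k + k + + (n ℕ.+ n)) ≡ w (σ i) (k + + n)
  w-double-shift i k n = trans (cong (w i) (double-+-pos-double k n)) (w-double i (k + + n))

  w-double+1-shift : ∀ i k n → w i (k + k + + 1 + + (n ℕ.+ n)) ≡ not (w (σ i) (k + + n))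
  w-double+1-shift i k n = trans (cong (w i) (double+1-+-pos-double k n)) (w-double+1 i (k + + n))

  alternates-at-even : ∀ i {z} → Even z → Alternates (w i) z
  alternates-at-even i (k , refl) = trans (w-double+1 i k) (cong not (sym (w-double i k)))

  no-period-one-overlap : ∀ i z → ¬ Overlap (w i) z 1
  no-period-one-overlap i z ov with even-or-odd z
  ... | inj₁ z-even = not-¬ (sym (trans (cong (w i) (sym (+-identityʳ z))) (period ov 0 z≤n)))
                            (alternates-at-even i z-even)
  ... | inj₂ z-odd  = not-¬ (trans (cong (w i) (+-assoc z (+ 1) (+ 1))) (sym (period ov 1 (s≤s z≤n))))
                            (alternates-at-even i (odd⇒suc-even z-odd))

  overlap-halve : ∀ i s r → Overlap (w i) s (r ℕ.+ r) → ∃[ k ] Overlap (w (σ i)) k r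
  overlap-halve i s r ov with even-or-odd s
  ... | inj₁ (k , refl) = k , mkOverlap λ j j≤r →
    trans (sym (w-double-shift i k j))
      (trans (overlap-at-doubles ov j j≤r) (w-double-shift i k (j ℕ.+ r)))
  ... | inj₂ (k , refl) = k , mkOverlap λ j j≤r → not-injective
    (trans (sym (w-double+1-shift i k j))
      (trans (overlap-at-doubles ov j j≤r) (w-double+1-shift i k (j ℕ.+ r))))

  odd-overlap-alternates : ∀ i {s p} → Odd (+ p) → Overlap (w i) s p →
                           ∀ j → suc j ≤ p ℕ.+ p → Alternates (w i) (s + + j)
  odd-overlap-alternates i {s} {p} p-odd ov j j<2p with even-or-odd (s + + j) | p ℕ.≤? j
  ... | inj₁ s+j-even | _ = alternates-at-even i s+j-even
  ... | inj₂ s+j-odd | no p≰j =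
    overlap-alternation-backward ov (ℕ.≰⇒> p≰j)
      (alternates-at-even i (subst Even (sym (+-pos-+ s j p)) (odd+odd-even s+j-odd p-odd)))
  ... | inj₂ s+j-odd | yes p≤j =
    subst (λ n → Alternates (w i) (s + + n)) d+p≡j
      (overlap-alternation-forward ov d<p
        (alternates-at-even i (subst Even s+j-p≡s+d (odd-odd-even s+j-odd p-odd))))
    where
    d = j ℕ.∸ p
    d+p≡j : d ℕ.+ p ≡ j
    d+p≡j = ℕ.m∸n+n≡m p≤j
    d<p : suc d ≤ p
    d<p = ℕ.+-cancelʳ-≤ p (suc d) p (subst (λ n → suc n ≤ p ℕ.+ p) (sym d+p≡j) j<2p)
    +-cancel : ∀ x y → x + y - y ≡ x
    +-cancel = solve-∀
    s+j-p≡s+d : s + + j - + p ≡ s + + d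
    s+j-p≡s+d = trans (cong (λ n → s + + n - + p) (sym d+p≡j))
                  (trans (cong (_- + p) (+-pos-+ s d p)) (+-cancel (s + + d) (+ p)))

  no-alternating-run-from-even : ∀ i s o c → s + + o ≡ c + c →
                                 (∀ n → n ≤ 3 → Alternates (w i) (s + + (n ℕ.+ o))) → ⊥
  no-alternating-run-from-even i s o c s+o≡2c alt = no-period-one-overlap (σ i) c (mkOverlap λ where
      0             _        → trans (sym (at 0)) (trans (sym (twice 0 (s≤s z≤n))) (at 1))
      1             _        → trans (sym (at 1)) (trans (sym (twice 2 ℕ.≤-refl)) (at 2))
      (suc (suc _)) (s≤s ()))
    where
    twice : ∀ n → suc n ≤ 3 → w i (s + + suc (suc (n ℕ.+ o))) ≡ w i (s + + (n ℕ.+ o))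
    twice n n<3 = alternates-twice {v = w i} {s = s} (alt n (ℕ.<⇒≤ n<3)) (alt (suc n) n<3)
    position : ∀ n → s + + ((n ℕ.+ n) ℕ.+ o) ≡ c + c + + (n ℕ.+ n)
    position n = begin
      s + + ((n ℕ.+ n) ℕ.+ o)  ≡⟨ cong (λ m → s + + m) (ℕ.+-comm (n ℕ.+ n) o) ⟩
      s + + (o ℕ.+ (n ℕ.+ n))  ≡⟨ +-pos-+ s o (n ℕ.+ n) ⟩
      s + + o + + (n ℕ.+ n)    ≡⟨ cong (λ x → x + + (n ℕ.+ n)) s+o≡2c ⟩
      c + c + + (n ℕ.+ n)      ∎
      where open ≡-Reasoning
    at : ∀ n → w i (s + + ((n ℕ.+ n) ℕ.+ o)) ≡ w (σ i) (c + + n)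
    at n = trans (cong (w i) (position n)) (w-double-shift i c n)

  no-odd-overlap : ∀ i s r → ¬ Overlap (w i) s (suc (r ℕ.+ r))
  no-odd-overlap i s zero    = no-period-one-overlap i s
  no-odd-overlap i s (suc r) ov =
    let o , o≤1 , c , s+o≡2c = even-within-one s in
    no-alternating-run-from-even i s o c s+o≡2c λ n n≤3 →
      odd-overlap-alternates i (odd-suc-double (suc r)) ov (n ℕ.+ o)
        (ℕ.≤-trans (ℕ.m≤n⇒m≤1+n (s≤s (ℕ.+-mono-≤ n≤3 o≤1))) (ℕ.+-mono-≤ 3≤p 3≤p))
    where
    3≤p : 3 ≤ suc (suc r ℕ.+ suc r)
    3≤p = s≤s (ℕ.+-mono-≤ (s≤s z≤n) (s≤s z≤n))

  overlap-free : ∀ i → OverlapFree (w i)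
  overlap-free i s p = <-rec P step p i s
    where
    P : ℕ → Set
    P p = ∀ i s → 1 ≤ p → ¬ Overlap (w i) s p
    step : ∀ p → (∀ {q} → q < p → P q) → P p
    step p rec i s 1≤p ov with parity p
    step .0 rec i s () ov | even zero
    ... | even (suc k) =
      let t , ov′ = overlap-halve i s (suc k) ov in
      rec (ℕ.m<m+n (suc k) (s≤s z≤n)) (σ i) t (s≤s z≤n) ov′
    ... | odd r = no-odd-overlap i s r ov

overlapFree-∘ : ∀ {A B : Set} {h : A → B} {v : ℤ → A} →
                Injective _≡_ _≡_ h → OverlapFree v → OverlapFree (h ∘ v)
overlapFree-∘ h-injective free s p 1≤p ov =
  free s p 1≤p (mkOverlap λ j j≤p → h-injective (period ov j j≤p))

module _ {k} (g : ℤ → Fin k) where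

  diagonal-frame⇒overlap : ∀ {m n p q} → IsFrame (λ m n → g (m + n)) m n p q →
                           ∃[ r ] 1 ≤ r × Overlap g (m + n) r
  diagonal-frame⇒overlap {m} {n} {p} {q} (1≤p , 1≤q , rows , cols) with ℕ.≤-total p q
  ... | inj₁ p≤q = p , 1≤p , mkOverlap λ j j≤p →
    trans (cong g (+-assoc m n (+ j)))
      (trans (rows j (ℕ.≤-trans j≤p p≤q)) (cong g (sym (row-end j))))
    where
    identity : ∀ m n a b → m + n + (a + b) ≡ (m + b) + (n + a)
    identity = solve-∀
    row-end : ∀ j → m + n + + (j ℕ.+ p) ≡ (m + + p) + (n + + j)
    row-end j = trans (cong (λ x → m + n + x) (pos-+ j p)) (identity m n (+ j) (+ p))
  ... | inj₂ q≤p = q , 1≤q , mkOverlap λ j j≤q →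
    trans (cong g (identity₀ m n (+ j)))
      (trans (cols j (ℕ.≤-trans j≤q q≤p)) (cong g (sym (col-end j))))
    where
    identity₀ : ∀ m n a → m + n + a ≡ (m + a) + n
    identity₀ = solve-∀
    identity : ∀ m n a b → m + n + (a + b) ≡ (m + a) + (n + b)
    identity = solve-∀
    col-end : ∀ j → m + n + + (j ℕ.+ q) ≡ (m + + j) + (n + + q)
    col-end j = trans (cong (λ x → m + n + x) (pos-+ j q)) (identity m n (+ j) (+ q))

  diagonal-frameless : OverlapFree g → Frameless (λ m n → g (m + n))
  diagonal-frameless free (m , n , p , q , frame) =
    let r , 1≤r , ov = diagonal-frame⇒overlap {m} {n} frame in free (m + n) r 1≤r ov

module ThueMorse = SelfSimilar not thueMorseℤ thueMorseℤ-double thueMorseℤ-double+1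

Bool↣Fin2 : Bool ↣ Fin 2
Bool↣Fin2 = ↔⇒↣ (↔-sym 2↔Bool)

theorem2 : ∃[ f ] Frameless {2} f
theorem2 =
    (λ m n → Injection.to Bool↣Fin2 (thueMorseℤ false (m + n)))
  , diagonal-frameless _
      (overlapFree-∘ (Injection.injective Bool↣Fin2) (ThueMorse.overlap-free false))
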